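{- Let $G=(V,E)$ be a finite undirected graph and let $U,W\subseteq V$ both be locally dense. Then $U\subseteq W$ or $W\subseteq U$.
   Context: For $X\subseteq V$, $E(X)=\{(x,y)\in E: x,y\in X\}$. For disjoint $X,Y\subseteq V$, $E(X,Y)=\{(x,y)\in E: x\in X, y\in Y\}$ (cross edges) and $E_m(X,Y)=E(X)\cup E(X,Y)$ (marginal edges). For nonempty $X$, the density is $d(X)=|E(X)|/|X|$. For nonempty $X$ disjoint from $Y$, the outer density is $d(X,Y)=|E_m(X,Y)|/|X|$; for general $X,Y$ one sets $d(X,Y)=d(X\setminus Y,Y)$. A set $W\subseteq V$ is called locally dense if there do not exist a nonempty $X\subseteq W$ and a nonempty $Y\subseteq V$ with $Y\cap W=\emptyset$ such that $d(X,W\setminus X)\le d(Y,W)$. -}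

module Defs where

open import Data.Nat.Base using (ℕ; zero; suc; _+_; _<ᵇ_)
open import Data.Bool.Base using (Bool; true; false; _∧_; if_then_else_)
open import Data.Fin.Base using (Fin; toℕ)
open import Data.Fin.Subset using (Subset; _─_; ∣_∣; Nonempty; Empty; _⊆_; _∩_)
open import Data.List.Base using (List; map; allFin)
open import Data.Nat.ListAction using (sum)
open import Data.Vec.Base using (lookup)
open import Data.Integer.Base using (+_)
open import Data.Rational.Unnormalised.Base using (ℚᵘ; mkℚᵘ; 0ℚᵘ; _≤_)
open import Data.Product.Base using (Σ; _×_)
open import Relation.Binary.PropositionalEquality using (_≡_)
open import Relation.Nullary using (¬_)

record Graph (n : ℕ) : Set where
  field
    adj    : Fin n → Fin n → Bool
    sym    : ∀ i j → adj i j ≡ adj j i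
    irrefl : ∀ i → adj i i ≡ false
open Graph public

private
  b2n : Bool → ℕ
  b2n true  = 1
  b2n false = 0

countPairs : ∀ {n} → (Fin n → Fin n → Bool) → ℕ
countPairs {n} p = sum (map (λ i → sum (map (λ j → b2n (p i j)) (allFin n))) (allFin n))

-- |E(X)| : number of (undirected) edges with both endpoints in X
-- (each edge {i,j} counted once, via i < j)
eIn : ∀ {n} → Graph n → Subset n → ℕ
eIn G X = countPairs (λ i j → (toℕ i <ᵇ toℕ j) ∧ lookup X i ∧ lookup X j ∧ adj G i j)

-- |E(X,Y)| : number of edges with one endpoint in X and the other in Y
-- (X, Y disjoint, so each edge counted once)
eCross : ∀ {n} → Graph n → Subset n → Subset n → ℕ
eCross G X Y = countPairs (λ i j → lookup X i ∧ lookup Y j ∧ adj G i j)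

eMarg : ∀ {n} → Graph n → Subset n → Subset n → ℕ
eMarg G X Y = eIn G X + eCross G X Y

-- the fraction a / b as an unnormalised rational (only used with b ≠ 0)
_÷_ : ℕ → ℕ → ℚᵘ
a ÷ zero  = 0ℚᵘ
a ÷ suc k = mkℚᵘ (+ a) k

density : ∀ {n} → Graph n → Subset n → ℚᵘ
density G X = eIn G X ÷ ∣ X ∣

outerDensity : ∀ {n} → Graph n → Subset n → Subset n → ℚᵘ
outerDensity G X Y = eMarg G (X ─ Y) Y ÷ ∣ X ─ Y ∣

LocallyDense : ∀ {n} → Graph n → Subset n → Set
LocallyDense G W =
  ¬ (Σ _ λ X → Σ _ λ Y →
       X ⊆ W × Nonempty X × Nonempty Y × Empty (Y ∩ W) ×
       outerDensity G X (W ─ X) ≤ outerDensity G Y W)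

-- If neither set contains the other, A = U ∖ W and B = W ∖ U are nonempty and disjoint
-- from W and U respectively. Local density of U (with X = A, Y = B) and of W (with X = B,
-- Y = A) give d(B, U) < d(A, U ∩ W) and d(A, W) < d(B, U ∩ W). Enlarging the second
-- argument of an outer density only adds cross edges, so d(A, U ∩ W) ≤ d(A, W) and
-- d(B, U ∩ W) ≤ d(B, U), which closes the cycle d(B, U) < d(B, U).
module Submission where

open import Defs
open import Data.Nat.Base using (ℕ; zero; suc; z≤n; s≤s) renaming (_≤_ to _≤ℕ_)
open import Data.Nat.Properties using (+-mono-≤; +-monoʳ-≤; +-cancelʳ-≤)
open import Data.Bool.Base using (Bool; true; false; _∧_)
open import Data.Fin.Base using (Fin; zero)
open import Data.Fin.Subset using (Subset; _⊆_; _⊈_; _─_; _∩_; ∣_∣; Nonempty; Empty; _∈_; _∉_; inside; outside)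
open import Data.Fin.Subset.Properties
  using (p─q⊆p; x∈p∩q⁺; x∈p∩q⁻; x∈p∧x∉q⇒x∈p─q; drop-∷-Empty; nonempty?; _⊆?_; _∈?_)
open import Data.Vec.Base using ([]; _∷_; lookup; here; there)
open import Data.Vec.Properties using ([]=⇒lookup; lookup⇒[]=)
open import Data.List.Base using (List; []; _∷_; map; allFin)
open import Data.Nat.ListAction using (sum)
open import Data.Integer.Base using (+_; +≤+)
open import Data.Integer.Properties using (*-monoʳ-≤-nonNeg)
open import Data.Rational.Unnormalised.Base using (*≤*) renaming (_≤_ to _≤q_)
open import Data.Rational.Unnormalised.Properties using (≤-refl; ≤-trans; ≤-total)
open import Data.Product.Base using (_,_)
open import Data.Sum.Base using (_⊎_; inj₁; inj₂)
open import Data.Empty using (⊥; ⊥-elim)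
open import Relation.Nullary using (¬_; yes; no; contradiction)
open import Relation.Nullary.Decidable using (decidable-stable)
open import Relation.Binary.PropositionalEquality using (_≡_; refl; cong)

sum-map-mono : ∀ {A : Set} {f g : A → ℕ} (xs : List A) →
               (∀ x → f x ≤ℕ g x) → sum (map f xs) ≤ℕ sum (map g xs)
sum-map-mono []       f≤g = z≤n
sum-map-mono (x ∷ xs) f≤g = +-mono-≤ (f≤g x) (sum-map-mono xs f≤g)

-- Defs keeps its 0/1 indicator of a Boolean private; counting a constant predicate
-- over Fin 1 computes that indicator plus two trailing zeros, which lets us name it.
indicator-mono : ∀ {a b : Bool} → (a ≡ true → b ≡ true) →
                 countPairs {1} (λ _ _ → a) ≤ℕ countPairs {1} (λ _ _ → b)
indicator-mono {false} {_}     _   = z≤n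
indicator-mono {true}  {true}  _   = s≤s z≤n
indicator-mono {true}  {false} a⇒b with a⇒b refl
... | ()

countPairs-mono : ∀ {n} {p q : Fin n → Fin n → Bool} →
                  (∀ i j → p i j ≡ true → q i j ≡ true) → countPairs p ≤ℕ countPairs q
countPairs-mono {n} p⇒q =
  sum-map-mono (allFin n) λ i → sum-map-mono (allFin n) λ j →
    +-cancelʳ-≤ 0 _ _ (+-cancelʳ-≤ 0 _ _ (indicator-mono (p⇒q i j)))

∧-mono-middle : ∀ a {b c} d → (b ≡ true → c ≡ true) → a ∧ b ∧ d ≡ true → a ∧ c ∧ d ≡ true
∧-mono-middle true {true} d b⇒c a∧b∧d with b⇒c refl
... | refl = a∧b∧d

⊆⇒lookup : ∀ {n} {p q : Subset n} → p ⊆ q → ∀ x → lookup p x ≡ true → lookup q x ≡ true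
⊆⇒lookup {p = p} p⊆q x px = []=⇒lookup (p⊆q (lookup⇒[]= x p px))

eCross-monoʳ : ∀ {n} (G : Graph n) (X : Subset n) {Y Y′ : Subset n} →
               Y ⊆ Y′ → eCross G X Y ≤ℕ eCross G X Y′
eCross-monoʳ G X Y⊆Y′ =
  countPairs-mono λ i j → ∧-mono-middle (lookup X i) (adj G i j) (⊆⇒lookup Y⊆Y′ j)

÷-monoˡ-≤ : ∀ {a b} k → a ≤ℕ b → a ÷ k ≤q b ÷ k
÷-monoˡ-≤ zero    _   = ≤-refl
÷-monoˡ-≤ (suc k) a≤b = *≤* (*-monoʳ-≤-nonNeg (+ suc k) (+≤+ a≤b))

x∈p─q⇒x∉q : ∀ {n} {p q : Subset n} {x} → x ∈ p ─ q → x ∉ q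
x∈p─q⇒x∉q {p = _ ∷ _} {outside ∷ _} here        ()
x∈p─q⇒x∉q {p = _ ∷ _} {_ ∷ _}       (there x∈) (there x∈q) = x∈p─q⇒x∉q x∈ x∈q

p─q∩q≡∅ : ∀ {n} (p q : Subset n) → Empty ((p ─ q) ∩ q)
p─q∩q≡∅ p q (x , x∈) with x∈p∩q⁻ (p ─ q) q x∈
... | x∈p─q , x∈q = x∈p─q⇒x∉q x∈p─q x∈q

p─[p─q]⊆q : ∀ {n} (p q : Subset n) → p ─ (p ─ q) ⊆ q
p─[p─q]⊆q p q {x} x∈ = decidable-stable (x ∈? q) λ x∉q →
  x∈p─q⇒x∉q x∈ (x∈p∧x∉q⇒x∈p─q (p─q⊆p p (p ─ q) x∈) x∉q)

p⊈q⇒p─q≢∅ : ∀ {n} {p q : Subset n} → p ⊈ q → Nonempty (p ─ q)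
p⊈q⇒p─q≢∅ {p = p} {q} p⊈q with nonempty? (p ─ q)
... | yes p─q≢∅ = p─q≢∅
... | no  p─q≡∅ = contradiction
  (λ {x} x∈p → decidable-stable (x ∈? q) λ x∉q → p─q≡∅ (x , x∈p∧x∉q⇒x∈p─q x∈p x∉q)) p⊈q

p∩q≡∅⇒p─q≡p : ∀ {n} (p q : Subset n) → Empty (p ∩ q) → p ─ q ≡ p
p∩q≡∅⇒p─q≡p []            []            _ = refl
p∩q≡∅⇒p─q≡p (s ∷ p)       (outside ∷ q) e = cong (s ∷_) (p∩q≡∅⇒p─q≡p p q (drop-∷-Empty e))
p∩q≡∅⇒p─q≡p (outside ∷ p) (inside ∷ q)  e = cong (outside ∷_) (p∩q≡∅⇒p─q≡p p q (drop-∷-Empty e))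
p∩q≡∅⇒p─q≡p (inside ∷ p)  (inside ∷ q)  e = contradiction (zero , here) e

Empty-∩-monoʳ : ∀ {n} (p : Subset n) {q r : Subset n} → q ⊆ r → Empty (p ∩ r) → Empty (p ∩ q)
Empty-∩-monoʳ p {q} q⊆r p∩r≡∅ (x , x∈) with x∈p∩q⁻ p q x∈
... | x∈p , x∈q = p∩r≡∅ (x , x∈p∩q⁺ (x∈p , q⊆r x∈q))

outerDensity-monoʳ : ∀ {n} (G : Graph n) {X Y Y′ : Subset n} →
                     Empty (X ∩ Y′) → Y ⊆ Y′ → outerDensity G X Y ≤q outerDensity G X Y′
outerDensity-monoʳ G {X} {Y} {Y′} X∩Y′≡∅ Y⊆Y′
  rewrite p∩q≡∅⇒p─q≡p X Y′ X∩Y′≡∅ | p∩q≡∅⇒p─q≡p X Y (Empty-∩-monoʳ X Y⊆Y′ X∩Y′≡∅) =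
  ÷-monoˡ-≤ ∣ X ∣ (+-monoʳ-≤ (eIn G X) (eCross-monoʳ G X Y⊆Y′))

outerDensity-─-≤ : ∀ {n} (G : Graph n) (U W : Subset n) →
                   outerDensity G (U ─ W) (U ─ (U ─ W)) ≤q outerDensity G (U ─ W) W
outerDensity-─-≤ G U W = outerDensity-monoʳ G (p─q∩q≡∅ U W) (p─[p─q]⊆q U W)

locallyDense⇒≰ : ∀ {n} (G : Graph n) {U W : Subset n} → LocallyDense G U →
                 Nonempty (U ─ W) → Nonempty (W ─ U) →
                 ¬ (outerDensity G (U ─ W) (U ─ (U ─ W)) ≤q outerDensity G (W ─ U) U)
locallyDense⇒≰ G {U} {W} dU U─W≢∅ W─U≢∅ ≤ =
  dU (U ─ W , W ─ U , p─q⊆p U W , U─W≢∅ , W─U≢∅ , p─q∩q≡∅ W U , ≤)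

locallyDense-differences-⊥ : ∀ {n} (G : Graph n) {U W : Subset n} →
                             LocallyDense G U → LocallyDense G W →
                             Nonempty (U ─ W) → Nonempty (W ─ U) → ⊥
locallyDense-differences-⊥ G {U} {W} dU dW U─W≢∅ W─U≢∅
  with ≤-total (outerDensity G (U ─ W) (U ─ (U ─ W))) (outerDensity G (W ─ U) U)
... | inj₁ ≤ = locallyDense⇒≰ G dU U─W≢∅ W─U≢∅ ≤
... | inj₂ ≥ = locallyDense⇒≰ G dW W─U≢∅ U─W≢∅
                (≤-trans (outerDensity-─-≤ G W U) (≤-trans ≥ (outerDensity-─-≤ G U W)))

proposition1 : ∀ {n : ℕ} (G : Graph n) (U W : Subset n) →
    LocallyDense G U → LocallyDense G W → U ⊆ W ⊎ W ⊆ U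
proposition1 G U W dU dW with U ⊆? W | W ⊆? U
... | yes U⊆W | _       = inj₁ U⊆W
... | no _    | yes W⊆U = inj₂ W⊆U
... | no U⊈W  | no W⊈U  =
  ⊥-elim (locallyDense-differences-⊥ G dU dW (p⊈q⇒p─q≢∅ U⊈W) (p⊈q⇒p─q≢∅ W⊈U))
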